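{- Let $A,B,C$ be distinct nullary relation symbols. Then in QPL the formulas $A\to B$ and $B\to C$ do not entail $A\to C$.
   Context: QPL is the Hilbert-style calculus over first-order formulas (no equality, no function symbols of positive arity; atomic formulas $\top,\bot,R(t_1,\dots,t_j)$; connectives $\land,\lor,\to$; quantifiers $\forall,\exists$) with rules (premises / conclusion): axioms $\top$ and $A\to A$; $A,B/A\land B$; $A\land B/A$, $A\land B/B$; $A/A\lor B$, $B/A\lor B$; $A\lor A/A$; $B/A\to B$; $A,A\to B/B$; $\bot/A$; $A/\forall xA$ ($x$ not free in $A$); $\forall xA(x)/A(t)$; $A(t)/\exists xA(x)$; $\exists xA/A$ ($x$ not free in $A$). A set of hypotheses entails a formula if there is a finite derivation tree of the formula whose leaves are axioms or hypotheses. -}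

module Defs where

open import Data.Nat using (ℕ; zero; suc)
open import Data.Vec using (Vec; map)
open import Data.Product using (_×_)
open import Data.Sum using (_⊎_)
open import Data.Vec using ([])
open import Relation.Binary.PropositionalEquality using (_≡_; sym) renaming (subst to ≡-subst)

-- A first-order signature without equality and without function symbols
-- of positive arity: relation symbols with arities, and constants.
record Signature : Set₁ where
  field
    Rel   : Set
    arity : Rel → ℕ
    Const : Set

module _ (S : Signature) where
  open Signature S

  data Term : Set where
    var : ℕ → Term
    con : Const → Term

  -- Formulas: ⊤, ⊥, R(t₁,…,t_j), ∧, ∨, →, ∀, ∃ (binders in de Bruijn style).
  data Formula : Set where
    ⊤' ⊥'      : Formula
    rel        : (R : Rel) → Vec Term (arity R) → Formula
    _∧'_ _∨'_ _⇒_ : Formula → Formula → Formula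
    all' ex'   : Formula → Formula

  Subst : Set
  Subst = ℕ → Term

  substTerm : Subst → Term → Term
  substTerm σ (var n) = σ n
  substTerm σ (con c) = con c

  shift : Term → Term
  shift = substTerm (λ n → var (suc n))

  lift : Subst → Subst
  lift σ zero    = var zero
  lift σ (suc n) = shift (σ n)

  subst : Subst → Formula → Formula
  subst σ ⊤' = ⊤'
  subst σ ⊥' = ⊥'
  subst σ (rel R ts) = rel R (map (substTerm σ) ts)
  subst σ (A ∧' B) = subst σ A ∧' subst σ B
  subst σ (A ∨' B) = subst σ A ∨' subst σ B
  subst σ (A ⇒ B) = subst σ A ⇒ subst σ B
  subst σ (all' A) = all' (subst (lift σ) A)
  subst σ (ex' A)  = ex' (subst (lift σ) A)

  -- weaken A : A viewed under one extra binder, in which the bound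
  -- variable does not occur free ("x not free in A").
  weaken : Formula → Formula
  weaken = subst (λ n → var (suc n))

  instantiate : Term → Formula → Formula
  instantiate t = subst σ
    where
    σ : Subst
    σ zero    = t
    σ (suc n) = var n

  data _⊢_ (Γ : Formula → Set) : Formula → Set where
    hyp    : ∀ {A} → Γ A → Γ ⊢ A
    ax⊤    : Γ ⊢ ⊤'
    axId   : ∀ {A} → Γ ⊢ (A ⇒ A)
    ∧I     : ∀ {A B} → Γ ⊢ A → Γ ⊢ B → Γ ⊢ (A ∧' B)
    ∧E₁    : ∀ {A B} → Γ ⊢ (A ∧' B) → Γ ⊢ A
    ∧E₂    : ∀ {A B} → Γ ⊢ (A ∧' B) → Γ ⊢ B
    ∨I₁    : ∀ {A B} → Γ ⊢ A → Γ ⊢ (A ∨' B)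
    ∨I₂    : ∀ {A B} → Γ ⊢ B → Γ ⊢ (A ∨' B)
    ∨C     : ∀ {A} → Γ ⊢ (A ∨' A) → Γ ⊢ A
    ⇒K     : ∀ {A B} → Γ ⊢ B → Γ ⊢ (A ⇒ B)
    mp     : ∀ {A B} → Γ ⊢ A → Γ ⊢ (A ⇒ B) → Γ ⊢ B
    ⊥E     : ∀ {A} → Γ ⊢ ⊥' → Γ ⊢ A
    ∀I     : ∀ {A} → Γ ⊢ A → Γ ⊢ all' (weaken A)
    ∀E     : ∀ {A} (t : Term) → Γ ⊢ all' A → Γ ⊢ instantiate t A
    ∃I     : ∀ {A} (t : Term) → Γ ⊢ instantiate t A → Γ ⊢ ex' A
    ∃E     : ∀ {A} → Γ ⊢ ex' (weaken A) → Γ ⊢ A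

  atom0 : (R : Rel) → arity R ≡ 0 → Formula
  atom0 R p = rel R (≡-subst (Vec Term) (sym p) [])

-- Evaluate a formula on its shape: the formula with all terms erased, so that
-- truth is invariant under substitution and the quantifier rules are sound.
-- Atoms are false, and an implication X → Y is true when Y is true, when X and
-- Y have the same shape, or when X and Y are atoms R, R' with R → R' licensed.
-- Every QPL rule preserves truth (modus ponens because a licensed implication
-- has a false antecedent), so licensing exactly A → B and B → C makes both
-- hypotheses true while A → C stays false.
module Submission where

open import Defs
open import Data.Sum using (_⊎_; inj₁; inj₂)
open import Data.Product using (_×_; _,_)
open import Data.Unit using (⊤; tt)
open import Data.Empty using (⊥; ⊥-elim)
open import Relation.Nullary using (¬_)
open import Relation.Binary.PropositionalEquality
  using (_≡_; _≢_; refl; sym; cong; cong₂) renaming (subst to ≡-subst)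

module _ (S : Signature) where
  open Signature S

  data Shape : Set where
    ⊤ˢ ⊥ˢ            : Shape
    relˢ             : Rel → Shape
    _∧ˢ_ _∨ˢ_ _⇒ˢ_   : Shape → Shape → Shape
    allˢ exˢ         : Shape → Shape

  shape : Formula S → Shape
  shape ⊤'         = ⊤ˢ
  shape ⊥'         = ⊥ˢ
  shape (rel R ts) = relˢ R
  shape (φ ∧' ψ)   = shape φ ∧ˢ shape ψ
  shape (φ ∨' ψ)   = shape φ ∨ˢ shape ψ
  shape (φ ⇒ ψ)    = shape φ ⇒ˢ shape ψ
  shape (all' φ)   = allˢ (shape φ)
  shape (ex' φ)    = exˢ (shape φ)

  shape-subst : ∀ σ φ → shape (subst S σ φ) ≡ shape φ
  shape-subst σ ⊤'        = refl
  shape-subst σ ⊥'        = refl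
  shape-subst σ (rel R _) = refl
  shape-subst σ (φ ∧' ψ)  = cong₂ _∧ˢ_ (shape-subst σ φ) (shape-subst σ ψ)
  shape-subst σ (φ ∨' ψ)  = cong₂ _∨ˢ_ (shape-subst σ φ) (shape-subst σ ψ)
  shape-subst σ (φ ⇒ ψ)   = cong₂ _⇒ˢ_ (shape-subst σ φ) (shape-subst σ ψ)
  shape-subst σ (all' φ)  = cong allˢ (shape-subst (lift S σ) φ)
  shape-subst σ (ex' φ)   = cong exˢ (shape-subst (lift S σ) φ)

module LicensedModel (S : Signature) (Licensed : Signature.Rel S → Signature.Rel S → Set) where

  LicensedShapes : Shape S → Shape S → Set
  LicensedShapes (relˢ R) (relˢ R′) = Licensed R R′
  LicensedShapes _        _         = ⊥

  Holds : Shape S → Set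
  Holds ⊤ˢ        = ⊤
  Holds ⊥ˢ        = ⊥
  Holds (relˢ R)  = ⊥
  Holds (X ∧ˢ Y)  = Holds X × Holds Y
  Holds (X ∨ˢ Y)  = Holds X ⊎ Holds Y
  Holds (X ⇒ˢ Y)  = Holds Y ⊎ X ≡ Y ⊎ LicensedShapes X Y
  Holds (allˢ X)  = Holds X
  Holds (exˢ X)   = Holds X

  Valid : Formula S → Set
  Valid φ = Holds (shape S φ)

  valid-subst : ∀ σ φ → Valid (subst S σ φ) → Valid φ
  valid-subst σ φ = ≡-subst Holds (shape-subst S σ φ)

  subst-valid : ∀ σ φ → Valid φ → Valid (subst S σ φ)
  subst-valid σ φ = ≡-subst Holds (sym (shape-subst S σ φ))

  licensed-antecedent-false : ∀ X Y → Holds X → ¬ LicensedShapes X Y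
  licensed-antecedent-false (relˢ R) (relˢ R′) ()

  modus-ponens-valid : ∀ X Y → Holds X → Holds (X ⇒ˢ Y) → Holds Y
  modus-ponens-valid X Y x (inj₁ y)          = y
  modus-ponens-valid X Y x (inj₂ (inj₁ X≡Y)) = ≡-subst Holds X≡Y x
  modus-ponens-valid X Y x (inj₂ (inj₂ l))   = ⊥-elim (licensed-antecedent-false X Y x l)

  sound : ∀ {Γ φ} → (∀ {ψ} → Γ ψ → Valid ψ) → _⊢_ S Γ φ → Valid φ
  sound valid-Γ (hyp γ)   = valid-Γ γ
  sound valid-Γ ax⊤       = tt
  sound valid-Γ axId      = inj₂ (inj₁ refl)
  sound valid-Γ (∧I d e)  = sound valid-Γ d , sound valid-Γ e
  sound valid-Γ (∧E₁ d) with sound valid-Γ d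
  ... | x , _ = x
  sound valid-Γ (∧E₂ d) with sound valid-Γ d
  ... | _ , y = y
  sound valid-Γ (∨I₁ d)   = inj₁ (sound valid-Γ d)
  sound valid-Γ (∨I₂ d)   = inj₂ (sound valid-Γ d)
  sound valid-Γ (∨C d) with sound valid-Γ d
  ... | inj₁ x = x
  ... | inj₂ x = x
  sound valid-Γ (⇒K d)    = inj₁ (sound valid-Γ d)
  sound valid-Γ (mp {A} {B} d e) =
    modus-ponens-valid (shape S A) (shape S B) (sound valid-Γ d) (sound valid-Γ e)
  sound valid-Γ (⊥E d)    = ⊥-elim (sound valid-Γ d)
  sound valid-Γ (∀I {A} d)   = subst-valid _ A (sound valid-Γ d)
  sound valid-Γ (∀E {A} t d) = subst-valid _ A (sound valid-Γ d)
  sound valid-Γ (∃I {A} t d) = valid-subst _ A (sound valid-Γ d)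
  sound valid-Γ (∃E {A} d)   = valid-subst _ A (sound valid-Γ d)

corollary7p4 : (S : Signature) (A B C : Signature.Rel S)
    (pA : Signature.arity S A ≡ 0) (pB : Signature.arity S B ≡ 0) (pC : Signature.arity S C ≡ 0)
    → A ≢ B → B ≢ C → A ≢ C
    → ¬ (_⊢_ S (λ φ → (φ ≡ (atom0 S A pA) ⇒ (atom0 S B pB)) ⊎ (φ ≡ (atom0 S B pB) ⇒ (atom0 S C pC)))
          ((atom0 S A pA) ⇒ (atom0 S C pC)))
corollary7p4 S A B C pA pB pC A≢B B≢C A≢C d = A⇒C-invalid (sound valid-hypotheses d)
  where
  Licensed : Signature.Rel S → Signature.Rel S → Set
  Licensed R R′ = (R ≡ A × R′ ≡ B) ⊎ (R ≡ B × R′ ≡ C)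

  open LicensedModel S Licensed

  valid-hypotheses : ∀ {φ} → (φ ≡ (atom0 S A pA) ⇒ (atom0 S B pB)) ⊎ (φ ≡ (atom0 S B pB) ⇒ (atom0 S C pC))
                   → Valid φ
  valid-hypotheses (inj₁ refl) = inj₂ (inj₂ (inj₁ (refl , refl)))
  valid-hypotheses (inj₂ refl) = inj₂ (inj₂ (inj₂ (refl , refl)))

  A⇒C-invalid : ¬ Valid ((atom0 S A pA) ⇒ (atom0 S C pC))
  A⇒C-invalid (inj₁ ())
  A⇒C-invalid (inj₂ (inj₁ refl))             = A≢C refl
  A⇒C-invalid (inj₂ (inj₂ (inj₁ (_ , C≡B)))) = B≢C (sym C≡B)
  A⇒C-invalid (inj₂ (inj₂ (inj₂ (A≡B , _)))) = A≢B A≡B
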